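{- ${\sf SCAC}\equiv_{sc}\mathsf{SCAC^{small}}\equiv_{sc}\mathsf{SCAC^{large}}\equiv_{sc}\mathsf{SCAC^{type}}$, i.e. these four problems are pairwise strongly computably reducible to one another.
   Context: A poset $(P,\le_P)$ consists of $P\subseteq\omega$ and a reflexive, antisymmetric, transitive relation $\le_P$; chains (antichains) are sets of pairwise comparable (incomparable) elements. In an infinite poset, $x$ is small if $x\le_P y$ for all but finitely many $y\in P$, large if $y\le_P x$ for all but finitely many $y$, isolated if $x$ is incomparable with all but finitely many $y$. A poset is stable if every element is small or isolated (small type) or every element is large or isolated (large type). ${\sf SCAC}$ has as instances infinite stable posets with $P\subseteq\omega$; $\mathsf{SCAC^{small}}$ (resp. $\mathsf{SCAC^{large}}$) is its restriction to instances of small (resp. large) type; $\mathsf{SCAC^{type}}$ has instances $(P,\le_P,T)$ with $(P,\le_P)$ an infinite stable poset, $T\in\{S,L\}$, and $T=S$ (resp. $L$) implying small (resp. large) type. In all cases solutions are infinite chains or infinite antichains of the poset. $\mathsf P\le_{sc}\mathsf Q$ means: for every $\mathsf P$-instance $X$ there is a $\mathsf Q$-instance $\hat X\le_T X$ such that for every solution $\hat Y$ of $\hat X$ there is a solution $Y$ of $X$ with $Y\le_T\hat Y$. -}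

module Defs where

open import Level using (0ℓ)
open import Data.Nat using (ℕ; zero; suc; _≤_; _<_)
open import Data.Fin using (Fin)
open import Data.Vec using (Vec; []; _∷_; lookup)
open import Data.Bool using (Bool; true; false)
open import Data.Product using (Σ; _×_; _,_)
open import Data.Sum using (_⊎_)
open import Relation.Binary.PropositionalEquality using (_≡_)
open import Relation.Nullary using (¬_)

Sub : Set
Sub = ℕ → Bool

χ : Bool → ℕ
χ true  = 1
χ false = 0

-- Oracle (relativised) partial recursive functions, Kleene-style codes.
-- Code k = code of a k-ary partial function; 'orc' queries the oracle.

data Code : ℕ → Set where
  zer  : ∀ {k} → Code k
  sc   : Code 1
  prj  : ∀ {k} → Fin k → Code k
  orc  : Code 1
  cmp  : ∀ {k m} → Code m → Vec (Code k) m → Code k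
  rec  : ∀ {k} → Code k → Code (suc (suc k)) → Code (suc k)
  mu   : ∀ {k} → Code (suc k) → Code k

-- Big-step semantics relative to oracle A: Eval A c xs z means Φ_c^A(xs) ↓ = z.
data Eval (A : Sub) : ∀ {k} → Code k → Vec ℕ k → ℕ → Set
data EvalV (A : Sub) : ∀ {k m} → Vec (Code k) m → Vec ℕ k → Vec ℕ m → Set

data Eval A where
  ezer  : ∀ {k} {xs : Vec ℕ k} → Eval A zer xs 0
  esc   : ∀ {x} → Eval A sc (x ∷ []) (suc x)
  eprj  : ∀ {k} {i : Fin k} {xs : Vec ℕ k} → Eval A (prj i) xs (lookup xs i)
  eorc  : ∀ {x} → Eval A orc (x ∷ []) (χ (A x))
  ecmp  : ∀ {k m} {f : Code m} {gs : Vec (Code k) m} {xs : Vec ℕ k} {ys : Vec ℕ m} {z} →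
          EvalV A gs xs ys → Eval A f ys z → Eval A (cmp f gs) xs z
  erec0 : ∀ {k} {g : Code k} {h : Code (suc (suc k))} {xs : Vec ℕ k} {z} →
          Eval A g xs z → Eval A (rec g h) (0 ∷ xs) z
  erecS : ∀ {k} {g : Code k} {h : Code (suc (suc k))} {xs : Vec ℕ k} {n r z} →
          Eval A (rec g h) (n ∷ xs) r → Eval A h (n ∷ r ∷ xs) z →
          Eval A (rec g h) (suc n ∷ xs) z
  emu   : ∀ {k} {f : Code (suc k)} {xs : Vec ℕ k} {y} →
          Eval A f (y ∷ xs) 0 →
          (∀ j → j < y → Σ ℕ (λ v → Eval A f (j ∷ xs) (suc v))) →
          Eval A (mu f) xs y

data EvalV A where
  []  : ∀ {k} {xs : Vec ℕ k} → EvalV A [] xs []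
  _∷_ : ∀ {k m} {g : Code k} {gs : Vec (Code k) m} {xs : Vec ℕ k} {y} {ys : Vec ℕ m} →
        Eval A g xs y → EvalV A gs xs ys → EvalV A (g ∷ gs) xs (y ∷ ys)

_≤T_ : Sub → Sub → Set
A ≤T B = Σ (Code 1) (λ c → ∀ n → Eval B c (n ∷ []) (χ (A n)))

-- A bijection ℕ → ℕ × ℕ (enumeration along diagonals), used to code
-- instances (tuples of sets) as single subsets of ω.

unpair : ℕ → ℕ × ℕ
unpair zero = (0 , 0)
unpair (suc n) with unpair n
... | (zero  , b) = (suc b , 0)
... | (suc a , b) = (a , suc b)

Rel₂ : Set
Rel₂ = ℕ → ℕ → Bool

_∈_ : ℕ → Sub → Set
x ∈ A = A x ≡ true

IsPoset : Sub → Rel₂ → Set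
IsPoset P R =
  (∀ x y → R x y ≡ true → (x ∈ P) × (y ∈ P)) ×
  (∀ x → x ∈ P → R x x ≡ true) ×
  (∀ x y → R x y ≡ true → R y x ≡ true → x ≡ y) ×
  (∀ x y z → R x y ≡ true → R y z ≡ true → R x z ≡ true)

Infinite : Sub → Set
Infinite A = ∀ n → Σ ℕ (λ m → n ≤ m × m ∈ A)

Cofin : Sub → (ℕ → Set) → Set
Cofin P Q = Σ ℕ (λ N → ∀ y → N ≤ y → y ∈ P → Q y)

IsSmall IsLarge IsIsolated : Sub → Rel₂ → ℕ → Set
IsSmall    P R x = Cofin P (λ y → R x y ≡ true)
IsLarge    P R x = Cofin P (λ y → R y x ≡ true)
IsIsolated P R x = Cofin P (λ y → (R x y ≡ false) × (R y x ≡ false))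

SmallType LargeType Stable : Sub → Rel₂ → Set
SmallType P R = ∀ x → x ∈ P → IsSmall P R x ⊎ IsIsolated P R x
LargeType P R = ∀ x → x ∈ P → IsLarge P R x ⊎ IsIsolated P R x
Stable P R = SmallType P R ⊎ LargeType P R

IsChain IsAntichain : Sub → Rel₂ → Sub → Set
IsChain P R Y = (∀ x → x ∈ Y → x ∈ P) ×
  (∀ x y → x ∈ Y → y ∈ Y → (R x y ≡ true) ⊎ (R y x ≡ true))
IsAntichain P R Y = (∀ x → x ∈ Y → x ∈ P) ×
  (∀ x y → x ∈ Y → y ∈ Y → ¬ (x ≡ y) → (R x y ≡ false) × (R y x ≡ false))

PosetSol : Sub → Rel₂ → Sub → Set
PosetSol P R Y = Infinite Y × (IsChain P R Y ⊎ IsAntichain P R Y)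

record Problem : Set₁ where
  field
    Inst  : Set              -- raw data of an instance
    Valid : Inst → Set
    code  : Inst → Sub       -- the instance as a subset of ω
    Sol   : Inst → Sub → Set
open Problem public

_≤sc_ : Problem → Problem → Set
P ≤sc Q = ∀ (X : Inst P) → Valid P X →
  Σ (Inst Q) (λ X̂ → Valid Q X̂ × (code Q X̂ ≤T code P X) ×
    (∀ Ŷ → Sol Q X̂ Ŷ → Σ Sub (λ Y → Sol P X Y × (Y ≤T Ŷ))))

_≡sc_ : Problem → Problem → Set
P ≡sc Q = (P ≤sc Q) × (Q ≤sc P)

PosetData : Set
PosetData = Sub × Rel₂

codePoset : PosetData → Sub
codePoset (P , R) n with unpair n
... | (0 , m) = P m
... | (1 , m) with unpair m
...   | (x , y) = R x y
codePoset (P , R) n | _ = false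

data Ty : Set where
  S L : Ty

tyBit : Ty → Bool
tyBit S = false
tyBit L = true

codeTyped : PosetData × Ty → Sub
codeTyped ((P , R) , T) n with unpair n
... | (2 , _) = tyBit T
... | _ = codePoset (P , R) n

StablePoset : PosetData → Set
StablePoset (P , R) = IsPoset P R × Infinite P × Stable P R

SCAC : Problem
SCAC = record
  { Inst = PosetData
  ; Valid = StablePoset
  ; code = codePoset
  ; Sol = λ { (P , R) Y → PosetSol P R Y } }

SCACsmall : Problem
SCACsmall = record
  { Inst = PosetData
  ; Valid = λ { (P , R) → StablePoset (P , R) × SmallType P R }
  ; code = codePoset
  ; Sol = λ { (P , R) Y → PosetSol P R Y } }

SCAClarge : Problem
SCAClarge = record
  { Inst = PosetData
  ; Valid = λ { (P , R) → StablePoset (P , R) × LargeType P R }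
  ; code = codePoset
  ; Sol = λ { (P , R) Y → PosetSol P R Y } }

SCACtype : Problem
SCACtype = record
  { Inst = PosetData × Ty
  ; Valid = λ { ((P , R) , T) → StablePoset (P , R) ×
                  (T ≡ S → SmallType P R) × (T ≡ L → LargeType P R) }
  ; code = codeTyped
  ; Sol = λ { ((P , R) , _) Y → PosetSol P R Y } }

module Submission where

-- Reversing the order of a stable poset exchanges small and large elements, keeps the
-- isolated ones, and maps chains and antichains to chains and antichains.  So an instance
-- of the wrong type can be replaced by its reversal, whose code is obtained from the code
-- of the original by a computable reindexing (this needs the Cantor pairing to be
-- computably invertible, which goes through the triangular root).  Tagging a small-type
-- instance with S, or forgetting the tag of a typed one, is again a computable reindexing.
-- Hence SCAC reduces to each of SCACsmall, SCAClarge and SCACtype and each of them reduces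
-- to SCAC; the other reductions follow by transitivity of ≤sc.

open import Level using (0ℓ)
open import Axiom.ExcludedMiddle using (ExcludedMiddle)
open import Data.Bool using (Bool; false)
open import Data.Fin using (Fin; #_)
open import Data.Nat using (ℕ; zero; suc; pred; _+_; _∸_; _≤_; _<_; z≤n; s≤s)
open import Data.Nat.Properties
open import Data.Product using (Σ; _×_; _,_; proj₁; proj₂; uncurry; swap)
open import Data.Sum using (inj₁; inj₂) renaming (map₂ to ⊎-map₂; swap to ⊎-swap)
open import Data.Vec using (Vec; []; _∷_; lookup)
open import Function using (_∘_; flip)
open import Relation.Binary.Definitions using (tri<; tri≈; tri>)
open import Relation.Binary.PropositionalEquality
open import Relation.Nullary using (yes; no; contradiction)

open import Defs

≤T-refl : ∀ {A} → A ≤T A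
≤T-refl = orc , λ n → eorc

mutual
  substOracle : ∀ {k} → Code 1 → Code k → Code k
  substOracle d zer        = zer
  substOracle d sc         = sc
  substOracle d (prj i)    = prj i
  substOracle d orc        = d
  substOracle d (cmp f gs) = cmp (substOracle d f) (substOracles d gs)
  substOracle d (rec g h)  = rec (substOracle d g) (substOracle d h)
  substOracle d (mu f)     = mu (substOracle d f)

  substOracles : ∀ {k m} → Code 1 → Vec (Code k) m → Vec (Code k) m
  substOracles d []       = []
  substOracles d (g ∷ gs) = substOracle d g ∷ substOracles d gs

module _ {B C : Sub} {d : Code 1} (d-decides-B : ∀ x → Eval C d (x ∷ []) (χ (B x))) where
  mutual
    eval-substOracle : ∀ {k} {c : Code k} {xs z} → Eval B c xs z → Eval C (substOracle d c) xs z
    eval-substOracle ezer          = ezer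
    eval-substOracle esc           = esc
    eval-substOracle eprj          = eprj
    eval-substOracle (eorc {x})    = d-decides-B x
    eval-substOracle (ecmp es e)   = ecmp (evalV-substOracle es) (eval-substOracle e)
    eval-substOracle (erec0 e)     = erec0 (eval-substOracle e)
    eval-substOracle (erecS e₁ e₂) = erecS (eval-substOracle e₁) (eval-substOracle e₂)
    eval-substOracle (emu e below) =
      emu (eval-substOracle e) λ j j<y → proj₁ (below j j<y) , eval-substOracle (proj₂ (below j j<y))

    evalV-substOracle : ∀ {k m} {gs : Vec (Code k) m} {xs zs} →
                        EvalV B gs xs zs → EvalV C (substOracles d gs) xs zs
    evalV-substOracle []       = []
    evalV-substOracle (e ∷ es) = eval-substOracle e ∷ evalV-substOracle es

≤T-trans : ∀ {A B C} → A ≤T B → B ≤T C → A ≤T C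
≤T-trans (c , c-decides-A) (d , d-decides-B) =
  substOracle d c , λ n → eval-substOracle d-decides-B (c-decides-A n)

Computable : ∀ {k} → (Vec ℕ k → ℕ) → Set
Computable {k} F = Σ (Code k) λ c → ∀ {A} xs → Eval A c xs (F xs)

Computable₁ : (ℕ → ℕ) → Set
Computable₁ f = Computable {1} λ xs → f (lookup xs (# 0))

Computable₂ : (ℕ → ℕ → ℕ) → Set
Computable₂ f = Computable {2} λ xs → f (lookup xs (# 0)) (lookup xs (# 1))

Computable₃ : (ℕ → ℕ → ℕ → ℕ) → Set
Computable₃ f = Computable {3} λ xs → f (lookup xs (# 0)) (lookup xs (# 1)) (lookup xs (# 2))

many-one⇒≤T : ∀ {A B} (h : ℕ → ℕ) → Computable₁ h → (∀ n → A n ≡ B (h n)) → A ≤T B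
many-one⇒≤T {A} {B} h (c , c-computes) A≡B∘h =
  cmp orc (c ∷ []) , λ n → subst (Eval B _ (n ∷ []) ∘ χ) (sym (A≡B∘h n)) (ecmp (c-computes (n ∷ []) ∷ []) eorc)

module _ {k : ℕ} where

  Computable-resp : {F G : Vec ℕ k → ℕ} → F ≗ G → Computable F → Computable G
  Computable-resp F≗G (c , c-computes) = c , λ xs → subst (Eval _ c xs) (F≗G xs) (c-computes xs)

  var-computable : (i : Fin k) → Computable (λ xs → lookup xs i)
  var-computable i = prj i , λ xs → eprj

  const-computable : (m : ℕ) → Computable {k} (λ _ → m)
  const-computable zero    = zer , λ xs → ezer
  const-computable (suc m) with const-computable m
  ... | c , c-computes = cmp sc (c ∷ []) , λ xs → ecmp (c-computes xs ∷ []) esc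

  compose₁ : ∀ {F G} → Computable {1} F → Computable {k} G → Computable (λ xs → F (G xs ∷ []))
  compose₁ (f , f-computes) (g , g-computes) =
    cmp f (g ∷ []) , λ xs → ecmp (g-computes xs ∷ []) (f-computes _)

  compose₂ : ∀ {F G H} → Computable {2} F → Computable {k} G → Computable {k} H →
             Computable (λ xs → F (G xs ∷ H xs ∷ []))
  compose₂ (f , f-computes) (g , g-computes) (h , h-computes) =
    cmp f (g ∷ h ∷ []) , λ xs → ecmp (g-computes xs ∷ h-computes xs ∷ []) (f-computes _)

  compose₃ : ∀ {F G H I} → Computable {3} F → Computable {k} G → Computable {k} H → Computable {k} I →
             Computable (λ xs → F (G xs ∷ H xs ∷ I xs ∷ []))
  compose₃ (f , f-computes) (g , g-computes) (h , h-computes) (i , i-computes) =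
    cmp f (g ∷ h ∷ i ∷ []) , λ xs → ecmp (g-computes xs ∷ h-computes xs ∷ i-computes xs ∷ []) (f-computes _)

module _ {k : ℕ} {G : Vec ℕ k → ℕ} {H : Vec ℕ (2 + k) → ℕ} (f : ℕ → Vec ℕ k → ℕ) where

  primrec-computable : Computable G → Computable H →
                       (∀ xs → f 0 xs ≡ G xs) → (∀ n xs → f (suc n) xs ≡ H (n ∷ f n xs ∷ xs)) →
                       Σ (Code (suc k)) λ c → ∀ {A} n xs → Eval A c (n ∷ xs) (f n xs)
  primrec-computable (g , g-computes) (h , h-computes) f-zero f-suc = rec g h , eval
    where
    eval : ∀ {A} n xs → Eval A (rec g h) (n ∷ xs) (f n xs)
    eval zero    xs = erec0 (subst (Eval _ g xs) (sym (f-zero xs)) (g-computes xs))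
    eval (suc n) xs = subst (Eval _ (rec g h) (suc n ∷ xs)) (sym (f-suc n xs)) (erecS (eval n xs) (h-computes _))

suc-computable : Computable₁ suc
suc-computable = sc , λ { (x ∷ []) → esc }

+-computable : Computable₂ _+_
+-computable with primrec-computable (λ m xs → m + lookup xs (# 0))
                    (var-computable (# 0)) (compose₁ suc-computable (var-computable (# 1))) (λ _ → refl) (λ _ _ → refl)
... | c , eval = c , λ { (m ∷ n ∷ []) → eval m (n ∷ []) }

pred-computable : Computable₁ pred
pred-computable with primrec-computable (λ n _ → pred n) (const-computable 0) (var-computable (# 0)) (λ _ → refl) (λ _ _ → refl)
... | c , eval = c , λ { (n ∷ []) → eval n [] }

∸-computable : Computable₂ _∸_
∸-computable with primrec-computable (λ n xs → lookup xs (# 0) ∸ n)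
                    (var-computable (# 0)) (compose₁ pred-computable (var-computable (# 1)))
                    (λ _ → refl) (λ n xs → sym (pred[m∸n]≡m∸[1+n] (lookup xs (# 0)) n))
... | c , eval = cmp c (prj (# 1) ∷ prj (# 0) ∷ []) , λ { (m ∷ n ∷ []) → ecmp (eprj ∷ eprj ∷ []) (eval n (m ∷ [])) }

ifZero : ℕ → ℕ → ℕ → ℕ
ifZero zero    x y = x
ifZero (suc _) x y = y

ifZero-computable : Computable₃ ifZero
ifZero-computable with primrec-computable (λ t xs → ifZero t (lookup xs (# 0)) (lookup xs (# 1)))
                         (var-computable (# 0)) (var-computable (# 3)) (λ _ → refl) (λ _ _ → refl)
... | c , eval = c , λ { (t ∷ x ∷ y ∷ []) → eval t (x ∷ y ∷ []) }

-- Cantor pairing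

tri : ℕ → ℕ
tri zero    = 0
tri (suc n) = suc n + tri n

tri-mono-≤ : ∀ {m n} → m ≤ n → tri m ≤ tri n
tri-mono-≤ z≤n       = z≤n
tri-mono-≤ (s≤s m≤n) = +-mono-≤ (s≤s m≤n) (tri-mono-≤ m≤n)

pair : ℕ → ℕ → ℕ
pair a b = tri (a + b) + b

-- 1 ∸ (m ∸ n) is 1 if m ≤ n and 0 otherwise.
triRoot : ℕ → ℕ
triRoot zero    = 0
triRoot (suc n) = triRoot n + (1 ∸ (tri (suc (triRoot n)) ∸ suc n))

IsTriRoot : ℕ → ℕ → Set
IsTriRoot n d = tri d ≤ n × n < tri (suc d)

triRoot-isTriRoot : ∀ n → IsTriRoot n (triRoot n)
triRoot-isTriRoot zero = z≤n , s≤s z≤n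
triRoot-isTriRoot (suc n) with triRoot n | triRoot-isTriRoot n
... | d | tri-d≤n , n<tri-sd with tri (suc d) ≤? suc n
...   | yes tri-sd≤sn rewrite m≤n⇒m∸n≡0 tri-sd≤sn | +-comm d 1 =
          tri-sd≤sn , ≤-trans (s≤s n<tri-sd) (s≤s (m≤n+m _ (suc d)))
...   | no tri-sd≰sn rewrite m≤n⇒m∸n≡0 (m<n⇒0<n∸m (≰⇒> tri-sd≰sn)) | +-identityʳ d =
          m≤n⇒m≤1+n tri-d≤n , ≰⇒> tri-sd≰sn

triRoot-unique : ∀ {n d e} → IsTriRoot n d → IsTriRoot n e → d ≡ e
triRoot-unique {d = d} {e} (tri-d≤n , n<tri-sd) (tri-e≤n , n<tri-se) with <-cmp d e
... | tri< d<e _ _ = contradiction (≤-trans (tri-mono-≤ d<e) tri-e≤n) (<⇒≱ n<tri-sd)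
... | tri≈ _ d≡e _ = d≡e
... | tri> _ _ e<d = contradiction (≤-trans (tri-mono-≤ e<d) tri-d≤n) (<⇒≱ n<tri-se)

pair-isTriRoot : ∀ a b → IsTriRoot (pair a b) (a + b)
pair-isTriRoot a b = m≤m+n (tri (a + b)) b , (begin-strict
  tri (a + b) + b           <⟨ +-monoʳ-< (tri (a + b)) (s≤s (m≤n+m b a)) ⟩
  tri (a + b) + suc (a + b) ≡⟨ +-comm (tri (a + b)) (suc (a + b)) ⟩
  tri (suc (a + b))         ∎)
  where open ≤-Reasoning

triRoot-pair : ∀ a b → triRoot (pair a b) ≡ a + b
triRoot-pair a b = triRoot-unique (triRoot-isTriRoot (pair a b)) (pair-isTriRoot a b)

decode : ℕ → ℕ × ℕ
decode n = triRoot n ∸ b , b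
  where b = n ∸ tri (triRoot n)

decode-pair : ∀ a b → decode (pair a b) ≡ (a , b)
decode-pair a b rewrite triRoot-pair a b | m+n∸m≡n (tri (a + b)) b = cong (_, b) (m+n∸n≡m a b)

nextPair : ℕ × ℕ → ℕ × ℕ
nextPair (zero  , b) = suc b , 0
nextPair (suc a , b) = a , suc b

unpair-suc : ∀ n → unpair (suc n) ≡ nextPair (unpair n)
unpair-suc n with unpair n
... | zero  , b = refl
... | suc a , b = refl

pair-nextPair : ∀ p → uncurry pair (nextPair p) ≡ suc (uncurry pair p)
pair-nextPair (zero , b)  rewrite +-identityʳ b | +-identityʳ (tri (suc b)) = cong suc (+-comm b (tri b))
pair-nextPair (suc a , b) rewrite +-suc a b = +-suc (tri (suc (a + b))) b

pair-unpair : ∀ n → uncurry pair (unpair n) ≡ n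
pair-unpair zero    = refl
pair-unpair (suc n) = begin
  uncurry pair (unpair (suc n))      ≡⟨ cong (uncurry pair) (unpair-suc n) ⟩
  uncurry pair (nextPair (unpair n)) ≡⟨ pair-nextPair (unpair n) ⟩
  suc (uncurry pair (unpair n))      ≡⟨ cong suc (pair-unpair n) ⟩
  suc n                              ∎
  where open ≡-Reasoning

unpair≡decode : ∀ n → unpair n ≡ decode n
unpair≡decode n = begin
  unpair n                         ≡⟨ sym (decode-pair (proj₁ (unpair n)) (proj₂ (unpair n))) ⟩
  decode (uncurry pair (unpair n)) ≡⟨ cong decode (pair-unpair n) ⟩
  decode n                         ∎
  where open ≡-Reasoning

unpair-pair : ∀ a b → unpair (pair a b) ≡ (a , b)
unpair-pair a b = trans (unpair≡decode (pair a b)) (decode-pair a b)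

tri-computable : Computable₁ tri
tri-computable with primrec-computable (λ n _ → tri n) (const-computable 0)
                      (compose₂ +-computable (compose₁ suc-computable (var-computable (# 0))) (var-computable (# 1)))
                      (λ _ → refl) (λ _ _ → refl)
... | c , eval = c , λ { (n ∷ []) → eval n [] }

pair-computable : ∀ {k G H} → Computable {k} G → Computable {k} H → Computable (λ xs → pair (G xs) (H xs))
pair-computable g h = compose₂ +-computable (compose₁ tri-computable (compose₂ +-computable g h)) h

triRoot-computable : Computable₁ triRoot
triRoot-computable with primrec-computable (λ n _ → triRoot n) (const-computable 0)
  (compose₂ +-computable (var-computable (# 1))
    (compose₂ ∸-computable (const-computable 1)
      (compose₂ ∸-computable (compose₁ tri-computable (compose₁ suc-computable (var-computable (# 1))))
                             (compose₁ suc-computable (var-computable (# 0))))))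
  (λ _ → refl) (λ _ _ → refl)
... | c , eval = c , λ { (n ∷ []) → eval n [] }

decode₂-computable : Computable₁ (proj₂ ∘ decode)
decode₂-computable =
  compose₂ ∸-computable (var-computable (# 0)) (compose₁ tri-computable (compose₁ triRoot-computable (var-computable (# 0))))

decode₁-computable : Computable₁ (proj₁ ∘ decode)
decode₁-computable = compose₂ ∸-computable (compose₁ triRoot-computable (var-computable (# 0))) decode₂-computable

unpair₁-computable : Computable₁ (proj₁ ∘ unpair)
unpair₁-computable = Computable-resp (λ xs → sym (cong proj₁ (unpair≡decode (lookup xs (# 0))))) decode₁-computable

unpair₂-computable : Computable₁ (proj₂ ∘ unpair)
unpair₂-computable = Computable-resp (λ xs → sym (cong proj₂ (unpair≡decode (lookup xs (# 0))))) decode₂-computable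

posetEntry : PosetData → ℕ × ℕ → Bool
posetEntry (P , R) (zero , m)        = P m
posetEntry (P , R) (suc zero , m)    = uncurry R (unpair m)
posetEntry (P , R) (suc (suc _) , m) = false

codePoset≡posetEntry : ∀ X n → codePoset X n ≡ posetEntry X (unpair n)
codePoset≡posetEntry (P , R) n with unpair n
... | zero , m = refl
... | suc zero , m with unpair m
...   | x , y = refl
codePoset≡posetEntry (P , R) n | suc (suc a) , m = refl

codePoset-entry : ∀ X n {p} → unpair n ≡ p → codePoset X n ≡ posetEntry X p
codePoset-entry X n eq = trans (codePoset≡posetEntry X n) (cong (posetEntry X) eq)

typedEntry : PosetData × Ty → ℕ × ℕ → Bool
typedEntry (X , T) (2 , m) = tyBit T
typedEntry (X , T) p       = posetEntry X p

codeTyped≡typedEntry : ∀ Y n → codeTyped Y n ≡ typedEntry Y (unpair n)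
codeTyped≡typedEntry ((P , R) , T) n with unpair n in eq
... | 2 , m                 = refl
... | zero , m              = codePoset-entry (P , R) n eq
... | suc zero , m          = codePoset-entry (P , R) n eq
... | suc (suc (suc a)) , m = codePoset-entry (P , R) n eq

byRow : ℕ → ℕ → ℕ → ℕ → ℕ
byRow t x y z = ifZero t x (ifZero (t ∸ 1) y z)

byRow-computable : ∀ {k T X Y Z} → Computable {k} T → Computable {k} X → Computable {k} Y → Computable {k} Z →
                   Computable (λ xs → byRow (T xs) (X xs) (Y xs) (Z xs))
byRow-computable t x y z =
  compose₃ ifZero-computable t x (compose₃ ifZero-computable (compose₂ ∸-computable t (const-computable 1)) y z)

-- R x y sits at index pair 1 (pair x y); this moves it to the index of R y x.
flipIndex : ℕ → ℕ
flipIndex n = byRow (proj₁ (unpair n)) n (pair 1 (pair (proj₂ (unpair m)) (proj₁ (unpair m)))) n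
  where m = proj₂ (unpair n)

flipIndex-computable : Computable₁ flipIndex
flipIndex-computable = byRow-computable (row n) n
  (pair-computable (const-computable 1) (pair-computable (column (column n)) (row (column n)))) n
  where
  n = var-computable (# 0)
  row : ∀ {G} → Computable {1} G → Computable (λ xs → proj₁ (unpair (G xs)))
  row = compose₁ unpair₁-computable
  column : ∀ {G} → Computable {1} G → Computable (λ xs → proj₂ (unpair (G xs)))
  column = compose₁ unpair₂-computable

codePoset-flip : ∀ P R n → codePoset (P , flip R) n ≡ codePoset (P , R) (flipIndex n)
codePoset-flip P R n with unpair n in eq
... | zero , m rewrite eq = refl
... | suc zero , m rewrite unpair-pair 1 (pair (proj₂ (unpair m)) (proj₁ (unpair m)))
                         | unpair-pair (proj₂ (unpair m)) (proj₁ (unpair m)) with unpair m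
...   | x , y = refl
codePoset-flip P R n | suc (suc a) , m rewrite eq = refl

-- Row 2 holds the type bit in codeTyped; it is sent to row 3, which is empty in both codings.
untypedIndex : ℕ → ℕ
untypedIndex n = byRow (proj₁ (unpair n)) n n (pair 3 0)

untypedIndex-computable : Computable₁ untypedIndex
untypedIndex-computable =
  byRow-computable (compose₁ unpair₁-computable n) n n (pair-computable (const-computable 3) (const-computable 0))
  where n = var-computable (# 0)

codePoset-untyped : ∀ X T n → codePoset X n ≡ codeTyped (X , T) (untypedIndex n)
codePoset-untyped X T n = begin
  codePoset X n                                ≡⟨ codePoset≡posetEntry X n ⟩
  posetEntry X (unpair n)                      ≡⟨ entry X ⟩
  typedEntry (X , T) (unpair (untypedIndex n)) ≡⟨ sym (codeTyped≡typedEntry (X , T) (untypedIndex n)) ⟩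
  codeTyped (X , T) (untypedIndex n)           ∎
  where
  open ≡-Reasoning
  entry : ∀ X → posetEntry X (unpair n) ≡ typedEntry (X , T) (unpair (untypedIndex n))
  entry (P , R) with unpair n in eq
  ... | zero , m rewrite eq     = refl
  ... | suc zero , m rewrite eq = refl
  ... | suc (suc a) , m         = refl

codeTyped-S : ∀ X n → codeTyped (X , S) n ≡ codePoset X n
codeTyped-S X n = begin
  codeTyped (X , S) n           ≡⟨ codeTyped≡typedEntry (X , S) n ⟩
  typedEntry (X , S) (unpair n) ≡⟨ entry (unpair n) ⟩
  posetEntry X (unpair n)       ≡⟨ sym (codePoset≡posetEntry X n) ⟩
  codePoset X n                 ∎
  where
  open ≡-Reasoning
  entry : ∀ p → typedEntry (X , S) p ≡ posetEntry X p
  entry (2 , m)                 = refl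
  entry (zero , m)              = refl
  entry (suc zero , m)          = refl
  entry (suc (suc (suc a)) , m) = refl

codePoset-flip-≤T : ∀ P R → codePoset (P , flip R) ≤T codePoset (P , R)
codePoset-flip-≤T P R = many-one⇒≤T flipIndex flipIndex-computable (codePoset-flip P R)

codePoset-≤T-codeTyped : ∀ X T → codePoset X ≤T codeTyped (X , T)
codePoset-≤T-codeTyped X T = many-one⇒≤T untypedIndex untypedIndex-computable (codePoset-untyped X T)

codeTyped-S-≤T : ∀ X → codeTyped (X , S) ≤T codePoset X
codeTyped-S-≤T X = many-one⇒≤T (λ n → n) (var-computable (# 0)) (codeTyped-S X)

module _ {P : Sub} {R : Rel₂} where

  flip-IsPoset : IsPoset P R → IsPoset P (flip R)
  flip-IsPoset (domain , reflexive , antisymmetric , transitive) =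
    (λ x y Ryx → swap (domain y x Ryx)) , reflexive ,
    (λ x y Ryx Rxy → antisymmetric x y Rxy Ryx) , (λ x y z Ryx Rzy → transitive z y x Rzy Ryx)

  flip-IsIsolated : ∀ {x} → IsIsolated P R x → IsIsolated P (flip R) x
  flip-IsIsolated (N , isolated) = N , λ y N≤y y∈P → swap (isolated y N≤y y∈P)

  flip-SmallType : SmallType P R → LargeType P (flip R)
  flip-SmallType small x x∈P = ⊎-map₂ flip-IsIsolated (small x x∈P)

  flip-LargeType : LargeType P R → SmallType P (flip R)
  flip-LargeType large x x∈P = ⊎-map₂ flip-IsIsolated (large x x∈P)

  flip-PosetSol : ∀ {Y} → PosetSol P (flip R) Y → PosetSol P R Y
  flip-PosetSol (infinite , inj₁ (Y⊆P , comparable)) =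
    infinite , inj₁ (Y⊆P , λ x y x∈Y y∈Y → ⊎-swap (comparable x y x∈Y y∈Y))
  flip-PosetSol (infinite , inj₂ (Y⊆P , incomparable)) =
    infinite , inj₂ (Y⊆P , λ x y x∈Y y∈Y x≢y → swap (incomparable x y x∈Y y∈Y x≢y))

≤sc-trans : ∀ {𝒫 𝒬 ℛ : Problem} → 𝒫 ≤sc 𝒬 → 𝒬 ≤sc ℛ → 𝒫 ≤sc ℛ
≤sc-trans {𝒫} {ℛ = ℛ} 𝒫≤𝒬 𝒬≤ℛ X X-valid with 𝒫≤𝒬 X X-valid
... | X′ , X′-valid , X′≤X , pull with 𝒬≤ℛ X′ X′-valid
...   | X″ , X″-valid , X″≤X′ , pull′ = X″ , X″-valid , ≤T-trans X″≤X′ X′≤X , pull″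
  where
  pull″ : ∀ Y″ → Sol ℛ X″ Y″ → Σ Sub λ Y → Sol 𝒫 X Y × (Y ≤T Y″)
  pull″ Y″ sol″ with pull′ Y″ sol″
  ... | Y′ , sol′ , Y′≤Y″ with pull Y′ sol′
  ...   | Y , sol , Y≤Y′ = Y , sol , ≤T-trans Y≤Y′ Y′≤Y″

≡sc-sym : ∀ {𝒫 𝒬} → 𝒫 ≡sc 𝒬 → 𝒬 ≡sc 𝒫
≡sc-sym = swap

≡sc-trans : ∀ {𝒫 𝒬 ℛ} → 𝒫 ≡sc 𝒬 → 𝒬 ≡sc ℛ → 𝒫 ≡sc ℛ
≡sc-trans (𝒫≤𝒬 , 𝒬≤𝒫) (𝒬≤ℛ , ℛ≤𝒬) = ≤sc-trans 𝒫≤𝒬 𝒬≤ℛ , ≤sc-trans ℛ≤𝒬 𝒬≤𝒫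

same-solutions : ∀ {IsSol : Sub → Set} Y → IsSol Y → Σ Sub λ Y′ → IsSol Y′ × (Y′ ≤T Y)
same-solutions Y sol = Y , sol , ≤T-refl

flipped-solutions : ∀ {P R} Y → PosetSol P (flip R) Y → Σ Sub λ Y′ → PosetSol P R Y′ × (Y′ ≤T Y)
flipped-solutions Y sol = Y , flip-PosetSol sol , ≤T-refl

SCAC≤SCACsmall : SCAC ≤sc SCACsmall
SCAC≤SCACsmall (P , R) (poset , infinite , inj₁ small) =
  (P , R) , ((poset , infinite , inj₁ small) , small) , ≤T-refl , same-solutions
SCAC≤SCACsmall (P , R) (poset , infinite , inj₂ large) =
  (P , flip R) , ((flip-IsPoset poset , infinite , inj₁ small) , small) , codePoset-flip-≤T P R , flipped-solutions
  where small = flip-LargeType large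

SCAC≤SCAClarge : SCAC ≤sc SCAClarge
SCAC≤SCAClarge (P , R) (poset , infinite , inj₂ large) =
  (P , R) , ((poset , infinite , inj₂ large) , large) , ≤T-refl , same-solutions
SCAC≤SCAClarge (P , R) (poset , infinite , inj₁ small) =
  (P , flip R) , ((flip-IsPoset poset , infinite , inj₂ large) , large) , codePoset-flip-≤T P R , flipped-solutions
  where large = flip-SmallType small

SCACsmall≤SCAC : SCACsmall ≤sc SCAC
SCACsmall≤SCAC (P , R) (valid , _) = (P , R) , valid , ≤T-refl , same-solutions

SCAClarge≤SCAC : SCAClarge ≤sc SCAC
SCAClarge≤SCAC (P , R) (valid , _) = (P , R) , valid , ≤T-refl , same-solutions

SCACsmall≤SCACtype : SCACsmall ≤sc SCACtype
SCACsmall≤SCACtype (P , R) (valid , small) =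
  ((P , R) , S) , (valid , (λ _ → small) , λ ()) , codeTyped-S-≤T (P , R) , same-solutions

SCACtype≤SCAC : SCACtype ≤sc SCAC
SCACtype≤SCAC ((P , R) , T) (valid , _) = (P , R) , valid , codePoset-≤T-codeTyped (P , R) T , same-solutions

-- The reductions are constructive.
corollary4 : ExcludedMiddle 0ℓ →
    (SCAC ≡sc SCACsmall) × (SCAC ≡sc SCAClarge) × (SCAC ≡sc SCACtype) ×
    (SCACsmall ≡sc SCAClarge) × (SCACsmall ≡sc SCACtype) × (SCAClarge ≡sc SCACtype)
corollary4 _ =
  small , large , typed ,
  ≡sc-trans (≡sc-sym small) large , ≡sc-trans (≡sc-sym small) typed , ≡sc-trans (≡sc-sym large) typed
  where
  small : SCAC ≡sc SCACsmall
  small = SCAC≤SCACsmall , SCACsmall≤SCAC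
  large : SCAC ≡sc SCAClarge
  large = SCAC≤SCAClarge , SCAClarge≤SCAC
  typed : SCAC ≡sc SCACtype
  typed = ≤sc-trans SCAC≤SCACsmall SCACsmall≤SCACtype , SCACtype≤SCAC
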